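{- Let $m,q$ be positive integers and let $\bm C_{m,q}=(c_{i,j})_{i,j\ge0}$ be the infinite diagonal matrix with $c_{i,i}=\mathrm{Card}(\mathrm{Aut}(\Delta^{(i)}_{m,q}))$ and $c_{i,j}=0$ for $i\ne j$. Then $\bm C_{m,q}$ is the Riordan matrix $T\!\left(\frac{m!}{q!}\,\Big|\,\frac1{q!}\right)$; in particular, if $m=q=1$, $\bm C_{m,q}$ is the identity matrix.
   Context: Posets are regarded as $T_0$ Alexandroff spaces; $\mathrm{Aut}(X)$ is the group of order automorphisms (self-homeomorphisms). $[k]$ is the antichain with $k$ points; $X\circledast Y$ is $X\sqcup Y$ with the orders of $X,Y$ and $x\le y$ for all $x\in X,y\in Y$. $\Delta^{(0)}_{m,q}=[m]$ and $\Delta^{(i)}_{m,q}=[m]\circledast[q]\circledast\cdots\circledast[q]$ ($i$ copies of $[q]$). For $\alpha,\omega\in\mathbb C[[x]]$ with $\alpha(0),\omega(0)\ne0$, $T(\alpha\mid\omega)=(d_{ij})$ with $d_{ij}=[x^i]\,x^j\alpha(x)/\omega(x)^{j+1}$. -}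

module Defs where

open import Data.Bool using (Bool; true; false; _∧_; _∨_; not; if_then_else_)
open import Data.Nat as ℕ using (ℕ; zero; suc; _∸_; _!; _≤ᵇ_)
open import Data.Nat.Properties using (_!≢0)
open import Data.Fin as Fin using (Fin; splitAt)
open import Data.Fin.Properties using () renaming (_≟_ to _≟ᶠ_)
open import Data.Sum using (inj₁; inj₂)
open import Data.List using (List; []; _∷_; [_]; map; concatMap; allFin; filter; length)
open import Data.Bool.ListAction using (all; any)
open import Data.Vec using (Vec; lookup) renaming ([] to []ᵛ; _∷_ to _∷ᵛ_)
open import Data.Integer using (+_)
open import Data.Rational using (ℚ; 0ℚ; 1ℚ; _+_; _*_; -_; 1/_; NonZero; _/_)
open import Data.Rational.Properties using (normalize-pos; pos⇒nonZero)
open import Relation.Nullary.Decidable using (⌊_⌋; does)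
open import Relation.Binary.PropositionalEquality using (_≡_)

-- Finite posets (T₀ Alexandroff spaces) on carrier Fin size,
-- with the order relation given as a Boolean-valued relation.

record FinPoset : Set where
  field
    size : ℕ
    le   : Fin size → Fin size → Bool
open FinPoset public

antichain : ℕ → FinPoset
antichain k = record { size = k ; le = λ x y → ⌊ x ≟ᶠ y ⌋ }

_⊛_ : FinPoset → FinPoset → FinPoset
X ⊛ Y = record { size = size X ℕ.+ size Y ; le = rel }
  where
  rel : Fin (size X ℕ.+ size Y) → Fin (size X ℕ.+ size Y) → Bool
  rel a b with splitAt (size X) a | splitAt (size X) b
  ... | inj₁ x | inj₁ x' = le X x x'
  ... | inj₂ y | inj₂ y' = le Y y y'
  ... | inj₁ _ | inj₂ _  = true
  ... | inj₂ _ | inj₁ _  = false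

infixl 5 _⊛_

Δ : ℕ → ℕ → ℕ → FinPoset
Δ m q zero    = antichain m
Δ m q (suc i) = Δ m q i ⊛ antichain q

_==ᵇ_ : Bool → Bool → Bool
true  ==ᵇ b = b
false ==ᵇ b = not b

allMaps : (n k : ℕ) → List (Vec (Fin k) n)
allMaps zero    k = [ []ᵛ ]
allMaps (suc n) k = concatMap (λ x → map (x ∷ᵛ_) (allMaps n k)) (allFin k)

-- σ is an order automorphism (self-homeomorphism) of X:
-- σ is a bijection and x ≤ y ⇔ σ x ≤ σ y for all x, y
isAut : (X : FinPoset) → (Fin (size X) → Fin (size X)) → Bool
isAut X σ =
  all (λ x → all (λ y → (le X x y ==ᵇ le X (σ x) (σ y))
                         ∧ (not ⌊ σ x ≟ᶠ σ y ⌋ ∨ ⌊ x ≟ᶠ y ⌋)) xs) xs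
  ∧ all (λ y → any (λ x → ⌊ σ x ≟ᶠ y ⌋) xs) xs
  where xs = allFin (size X)

cardAut : FinPoset → ℕ
cardAut X = length (filter (λ v → isAut X (lookup v) ≟ᵇ true) (allMaps (size X) (size X)))
  where
  open import Data.Bool.Properties using () renaming (_≟_ to _≟ᵇ_)

fromℕ : ℕ → ℚ
fromℕ n = (+ n) / 1

C : ℕ → ℕ → ℕ → ℕ → ℚ
C m q i j = if ⌊ i ℕ.≟ j ⌋ then fromℕ (cardAut (Δ m q i)) else 0ℚ

PS : Set
PS = ℕ → ℚ

sumTo : ℕ → (ℕ → ℚ) → ℚ
sumTo zero    f = f 0
sumTo (suc n) f = sumTo n f + f (suc n)

constPS : ℚ → PS
constPS c zero    = c
constPS c (suc _) = 0ℚ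

_·_ : PS → PS → PS
(a · b) n = sumTo n (λ k → a k * b (n ∸ k))

_^ₚ_ : PS → ℕ → PS
a ^ₚ zero  = constPS 1ℚ
a ^ₚ suc k = a · (a ^ₚ k)

xPow : ℕ → PS → PS
xPow j a n = if j ≤ᵇ n then a (n ∸ j) else 0ℚ

-- multiplicative inverse 1/ω of a series with ω(0) ≠ 0:
-- b₀ = 1/ω₀,  b_n = -(1/ω₀) Σ_{k=1}^{n} ω_k b_{n-k}
module _ (ω : PS) .{{_ : NonZero (ω 0)}} where
  private
    invAux : ℕ → PS
    invAux zero    k = 1/ (ω 0)
    invAux (suc n) k =
      if k ≤ᵇ n then invAux n k
      else - (1/ (ω 0)) * sumTo n (λ k' → ω (suc k') * invAux n (n ∸ k'))
  invPS : PS
  invPS n = invAux n n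

-- Riordan matrix T(α | ω): d_{ij} = [x^i] x^j α(x) / ω(x)^{j+1}
T : (α ω : PS) → .{{NonZero (ω 0)}} → ℕ → ℕ → ℚ
T α ω i j = xPow j (α · (invPS ω ^ₚ suc j)) i

αₘ,q : ℕ → ℕ → PS
αₘ,q m q = constPS (_/_ (+ (m !)) (q !) {{q !≢0}})

ωq : ℕ → PS
ωq q = constPS (_/_ (+ 1) (q !) {{q !≢0}})

ωq-nonZero : ∀ q → NonZero (ωq q 0)
ωq-nonZero q = pos⇒nonZero (ωq q 0) {{normalize-pos 1 (q !) {{q !≢0}}}}

I : ℕ → ℕ → ℚ
I i j = if ⌊ i ℕ.≟ j ⌋ then 1ℚ else 0ℚ

{-# OPTIONS --safe #-}

-- Every automorphism of X ⊛ [q] maps the maximal points, which are exactly the points of [q],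
-- onto themselves, so it splits into an automorphism of X and a permutation of [q]; hence
-- Card Aut Δ⁽ⁱ⁾ = m! (q!)ⁱ. On the other side, m!/q! and 1/q! are constant series, so
-- T(m!/q! | 1/q!) is diagonal with entries (m!/q!) (q!)ⁱ⁺¹ = m! (q!)ⁱ.

module Submission where

open import Defs
open import Data.Nat using (ℕ; _>_)
open import Data.Product using (_×_)
open import Relation.Binary.PropositionalEquality using (_≡_)

open import Axiom.UniquenessOfIdentityProofs using (module Decidable⇒UIP)
open import Data.Bool using (Bool; true; false; not; _∨_; if_then_else_)
import Data.Bool as Bool using (T)
open import Data.Bool.ListAction using (all; any)
open import Data.Bool.Properties using (T-∧; T-≡; if-cong; if-cong-then) renaming (_≟_ to _≟ᵇ_)
open import Data.Fin using (Fin; zero; suc; punchIn; punchOut; _↑ˡ_; _↑ʳ_; splitAt; join)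
open import Data.Fin.Permutation
  using (Permutation; Permutation′; permutation; _⟨$⟩ʳ_; _⟨$⟩ˡ_; inverseˡ; inverseʳ; _≈_;
         remove; insert; remove-insert; insert-remove; ↔⇒≡)
open import Data.Fin.Properties
  using (punchOut-cong; *↔×; ↑ˡ-injective; ↑ʳ-injective; splitAt-↑ˡ; splitAt-↑ʳ;
         splitAt⁻¹-↑ˡ; splitAt⁻¹-↑ʳ; splitAt-join; join-splitAt)
  renaming (_≟_ to _≟ᶠ_)
open import Data.Integer using (+_)
import Data.Integer as ℤ
open import Data.Integer.Properties using (pos-*)
import Data.List as List
open import Data.List
  using (List; []; _∷_; map; _++_; concatMap; cartesianProductWith; allFin; filter; length)
open import Data.List.Membership.Propositional using (_∈_)
open import Data.List.Membership.Propositional.Properties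
  using (∈-allFin; ∈-lookup; ∈-filter⁺; ∈-filter⁻; ∈-cartesianProductWith⁺)
open import Data.List.Membership.Setoid.Properties using (unique⇒irrelevant)
import Data.List.Relation.Unary.All as All
import Data.List.Relation.Unary.All.Properties as All
import Data.List.Relation.Unary.Any as Any
import Data.List.Relation.Unary.Any.Properties as Any
open import Data.List.Relation.Unary.Any using (here)
open import Data.List.Relation.Unary.AllPairs using ([]; _∷_)
open import Data.List.Relation.Unary.Unique.Propositional using (Unique)
open import Data.List.Relation.Unary.Unique.Propositional.Properties
  using (cartesianProductWith⁺; allFin⁺; filter⁺)
import Data.Nat as ℕ
open import Data.Nat using (zero; suc; _+_; _∸_; _*_; _^_; _!; _≤ᵇ_; _≤?_)
open import Data.Nat.Properties
  using (_!≢0; ^-zeroˡ; *-identityʳ; *-assoc; *-comm; ≤-refl; ≤-antisym; n≮n; n∸n≡0; m∸n≡0⇒m≤n;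
         ≤ᵇ⇒≤)
open import Data.Product using (∃-syntax; ∃₂; _,_; proj₁; proj₂)
open import Data.Product.Function.Dependent.Propositional using (Σ-↔)
open import Data.Product.Function.NonDependent.Propositional using (_×-↔_)
open import Data.Product.Properties using (Σ-≡,≡→≡)
import Data.Rational as ℚ
open import Data.Rational using (ℚ; 0ℚ; 1ℚ; _/_; 1/_; NonZero)
import Data.Rational.Properties as ℚ
import Data.Rational.Unnormalised as ℚᵘ
import Data.Rational.Unnormalised.Properties as ℚᵘ
open import Data.Sum using (_⊎_; inj₁; inj₂)
import Data.Sum as Sum
import Data.Sum.Properties as Sum
open import Data.Unit using (tt)
open import Data.Vec using (Vec; lookup; tabulate) renaming ([] to []ᵛ; _∷_ to _∷ᵛ_)
open import Data.Vec.Properties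
  using (∷-injective; lookup∘tabulate; tabulate∘lookup; tabulate-cong; ≡-dec)
open import Function using (id; _∘_; const; _↔_; _⇔_; mk↔ₛ′; mk⇔; Equivalence)
open import Function.Properties.Inverse using (↔-refl; ↔-sym; ↔-trans)
open import Relation.Binary.Definitions using (DecidableEquality)
open import Relation.Binary.PropositionalEquality
  using (_≢_; refl; sym; trans; cong; cong₂; subst; _≗_; setoid; module ≡-Reasoning)
open import Relation.Nullary.Decidable
  using (Dec; yes; no; ⌊_⌋; toWitness; fromWitness; isYes≗does; does-⇔; dec-true; dec-false)
open import Relation.Nullary.Negation using (¬_; contradiction)

open import Algebra.Definitions.RawSemiring ℚ.+-*-rawSemiring using () renaming (_^_ to _^ℚ_)
open Equivalence using (to; from)

-- Counting automorphisms

-- An automorphism is kept as its table of values, as enumerated by cardAut, so that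
-- automorphisms agreeing pointwise are equal (Aut-ext).
record Aut (X : FinPoset) : Set where
  constructor aut
  field
    table      : Vec (Fin (size X)) (size X)
    isAut-true : isAut X (lookup table) ≡ true

concatMap-map≡cartesianProductWith : ∀ {A B C : Set} (f : A → B → C) xs ys →
  concatMap (λ x → map (f x) ys) xs ≡ cartesianProductWith f xs ys
concatMap-map≡cartesianProductWith f []       ys = refl
concatMap-map≡cartesianProductWith f (x ∷ xs) ys =
  cong (map (f x) ys ++_) (concatMap-map≡cartesianProductWith f xs ys)

allMaps-unique : ∀ n k → Unique (allMaps n k)
allMaps-unique zero    k = All.[] ∷ []
allMaps-unique (suc n) k =
  subst Unique (sym (concatMap-map≡cartesianProductWith _∷ᵛ_ (allFin k) (allMaps n k)))
    (cartesianProductWith⁺ _∷ᵛ_ ∷-injective (allFin⁺ k) (allMaps-unique n k))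

∈-allMaps : ∀ {n k} (v : Vec (Fin k) n) → v ∈ allMaps n k
∈-allMaps []ᵛ                  = here refl
∈-allMaps {suc n} {k} (x ∷ᵛ v) =
  subst (x ∷ᵛ v ∈_) (sym (concatMap-map≡cartesianProductWith _∷ᵛ_ (allFin k) (allMaps n k)))
    (∈-cartesianProductWith⁺ _∷ᵛ_ (∈-allFin x) (∈-allMaps v))

index-∈-lookup : ∀ {A : Set} (xs : List A) i → Any.index (∈-lookup {xs = xs} i) ≡ i
index-∈-lookup (x ∷ xs) zero    = refl
index-∈-lookup (x ∷ xs) (suc i) = cong suc (index-∈-lookup xs i)

module _ {A : Set} (_≟ᴬ_ : DecidableEquality A) where

  private
    ∈-irrelevant : ∀ {xs} → Unique xs → ∀ {x} (p q : x ∈ xs) → p ≡ q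
    ∈-irrelevant = unique⇒irrelevant (setoid A) (Decidable⇒UIP.≡-irrelevant _≟ᴬ_)

  Fin-length↔∈ : ∀ {xs} → Unique xs → Fin (length xs) ↔ (∃[ x ] x ∈ xs)
  Fin-length↔∈ {xs} xs-unique =
    mk↔ₛ′ (λ i → List.lookup xs i , ∈-lookup i) (λ (_ , x∈xs) → Any.index x∈xs)
      (λ (_ , x∈xs) → Σ-≡,≡→≡ (sym (Any.lookup-index x∈xs) , ∈-irrelevant xs-unique _ _))
      (index-∈-lookup xs)

  Fin-length-filter↔ : (p : A → Bool) {xs : List A} → Unique xs → (∀ x → x ∈ xs) →
                       Fin (length (filter (λ x → p x ≟ᵇ true) xs)) ↔ (∃[ x ] p x ≡ true)
  Fin-length-filter↔ p {xs} xs-unique xs-complete =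
    ↔-trans (Fin-length↔∈ (filter⁺ P? xs-unique)) (Σ-↔ ↔-refl ∈-filter↔)
    where
    P? : ∀ x → Dec (p x ≡ true)
    P? x = p x ≟ᵇ true
    ∈-filter↔ : ∀ {x} → x ∈ filter P? xs ↔ p x ≡ true
    ∈-filter↔ = mk↔ₛ′ (proj₂ ∘ ∈-filter⁻ P? {xs = xs}) (∈-filter⁺ P? (xs-complete _))
      (λ _ → Decidable⇒UIP.≡-irrelevant _≟ᵇ_ _ _)
      (λ _ → ∈-irrelevant (filter⁺ P? xs-unique) _ _)

Aut↔Fin-cardAut : ∀ X → Aut X ↔ Fin (cardAut X)
Aut↔Fin-cardAut X =
  ↔-trans Aut↔Σ (↔-sym (Fin-length-filter↔ (≡-dec _≟ᶠ_) (isAut X ∘ lookup)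
                                           (allMaps-unique (size X) (size X)) ∈-allMaps))
  where
  Aut↔Σ : Aut X ↔ (∃[ v ] isAut X (lookup v) ≡ true)
  Aut↔Σ = mk↔ₛ′ (λ (aut v p) → v , p) (λ (v , p) → aut v p) (λ _ → refl) (λ _ → refl)

cardAut-↔ : ∀ {X c} → Aut X ↔ Fin c → cardAut X ≡ c
cardAut-↔ {X} Aut↔Fin = ↔⇒≡ (↔-trans (↔-sym (Aut↔Fin-cardAut X)) Aut↔Fin)

×-Fin↔ : ∀ {A B : Set} {a b} → A ↔ Fin a → B ↔ Fin b → (A × B) ↔ Fin (a * b)
×-Fin↔ A↔Fin B↔Fin = ↔-trans (A↔Fin ×-↔ B↔Fin) (↔-sym *↔×)

record IsAutomorphism (X : FinPoset) (σ : Fin (size X) → Fin (size X)) : Set where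
  field
    le-preserved : ∀ x y → le X x y ≡ le X (σ x) (σ y)
    injective    : ∀ {x y} → σ x ≡ σ y → x ≡ y
    surjective   : ∀ y → ∃[ x ] σ x ≡ y

IsAutomorphism-resp-≗ : ∀ {X σ τ} → σ ≗ τ → IsAutomorphism X σ → IsAutomorphism X τ
IsAutomorphism-resp-≗ {X} σ≗τ σ-aut = record
  { le-preserved = λ x y → trans (le-preserved x y) (cong₂ (le X) (σ≗τ x) (σ≗τ y))
  ; injective    = λ {x} {y} τx≡τy → injective (trans (σ≗τ x) (trans τx≡τy (sym (σ≗τ y))))
  ; surjective   = λ y → let x , σx≡y = surjective y in x , trans (sym (σ≗τ x)) σx≡y
  }
  where open IsAutomorphism σ-aut

T-==ᵇ : ∀ {a b} → Bool.T (a ==ᵇ b) ⇔ a ≡ b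
T-==ᵇ {true}  {true}  = mk⇔ (const refl) (const tt)
T-==ᵇ {true}  {false} = mk⇔ (λ ()) (λ ())
T-==ᵇ {false} {true}  = mk⇔ (λ ()) (λ ())
T-==ᵇ {false} {false} = mk⇔ (const refl) (const tt)

T-not-∨ : ∀ a {b} → Bool.T (not a ∨ b) ⇔ (Bool.T a → Bool.T b)
T-not-∨ true  = mk⇔ const (λ f → f tt)
T-not-∨ false = mk⇔ (λ _ ()) (const tt)

T-all-allFin : ∀ {n} (p : Fin n → Bool) → Bool.T (all p (allFin n)) ⇔ (∀ i → Bool.T (p i))
T-all-allFin p = mk⇔ (All.tabulate⁻ ∘ All.all⁺ p _) (All.all⁻ p ∘ All.tabulate⁺)

T-any-allFin : ∀ {n} (p : Fin n → Bool) → Bool.T (any p (allFin n)) ⇔ (∃[ i ] Bool.T (p i))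
T-any-allFin {n} p = mk⇔ (Any.satisfied ∘ Any.any⁻ p (allFin n))
                         (λ (i , pi) → Any.any⁺ p (Any.tabulate⁺ {f = id} i pi))

T-isAut : ∀ X σ → Bool.T (isAut X σ) ⇔ IsAutomorphism X σ
T-isAut X σ = mk⇔ checked⇒aut aut⇒checked
  where
  open IsAutomorphism
  checked⇒aut : Bool.T (isAut X σ) → IsAutomorphism X σ
  checked⇒aut t = record
    { le-preserved = λ x y → to T-==ᵇ (proj₁ (entry x y))
    ; injective    = λ {x} {y} σx≡σy →
        toWitness (to (T-not-∨ ⌊ σ x ≟ᶠ σ y ⌋) (proj₂ (entry x y)) (fromWitness σx≡σy))
    ; surjective   = λ y →
        let x , hit = to (T-any-allFin _) (to (T-all-allFin _) (proj₂ (to T-∧ t)) y) in x , toWitness hit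
    }
    where
    entry : ∀ x y → Bool.T (le X x y ==ᵇ le X (σ x) (σ y)) × Bool.T (not ⌊ σ x ≟ᶠ σ y ⌋ ∨ ⌊ x ≟ᶠ y ⌋)
    entry x y = to T-∧ (to (T-all-allFin _) (to (T-all-allFin _) (proj₁ (to T-∧ t)) x) y)
  aut⇒checked : IsAutomorphism X σ → Bool.T (isAut X σ)
  aut⇒checked σ-aut = from T-∧
    ( from (T-all-allFin _) (λ x → from (T-all-allFin _) (λ y → from T-∧
        ( from T-==ᵇ (le-preserved σ-aut x y)
        , from (T-not-∨ ⌊ σ x ≟ᶠ σ y ⌋) (fromWitness ∘ injective σ-aut ∘ toWitness))))
    , from (T-all-allFin _) (λ y → let x , σx≡y = surjective σ-aut y
                                   in from (T-any-allFin _) (x , fromWitness σx≡y)))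

module _ {X : FinPoset} where

  toAut : ∀ {σ} → IsAutomorphism X σ → Aut X
  toAut {σ} σ-aut = aut (tabulate σ)
    (to T-≡ (from (T-isAut X _) (IsAutomorphism-resp-≗ (sym ∘ lookup∘tabulate σ) σ-aut)))

  ⟦_⟧ : Aut X → Fin (size X) → Fin (size X)
  ⟦ a ⟧ = lookup (Aut.table a)

  ⟦⟧-isAutomorphism : (a : Aut X) → IsAutomorphism X ⟦ a ⟧
  ⟦⟧-isAutomorphism (aut v isAut-true) = to (T-isAut X (lookup v)) (from T-≡ isAut-true)

  ⟦toAut⟧ : ∀ {σ} (σ-aut : IsAutomorphism X σ) → ⟦ toAut σ-aut ⟧ ≗ σ
  ⟦toAut⟧ {σ} _ = lookup∘tabulate σ

  Aut-ext : ∀ {a b : Aut X} → ⟦ a ⟧ ≗ ⟦ b ⟧ → a ≡ b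
  Aut-ext {aut v _} {aut w _} v≗w
    with refl ← trans (sym (tabulate∘lookup v)) (trans (tabulate-cong v≗w) (tabulate∘lookup w))
    = cong (aut v) (Decidable⇒UIP.≡-irrelevant _≟ᵇ_ _ _)

toPermutation : ∀ {X σ} → IsAutomorphism X σ → Permutation′ (size X)
toPermutation {σ = σ} σ-aut =
  permutation σ (proj₁ ∘ surjective) (proj₂ ∘ surjective)
    (λ x → injective (proj₂ (surjective (σ x))))
  where open IsAutomorphism σ-aut

IsMaximal : (X : FinPoset) → Fin (size X) → Set
IsMaximal X x = ∀ y → le X x y ≡ true → y ≡ x

module _ {X σ} (σ-aut : IsAutomorphism X σ) where
  open IsAutomorphism σ-aut

  IsMaximal-preserved : ∀ {x} → IsMaximal X x → IsMaximal X (σ x)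
  IsMaximal-preserved {x} x-maximal y σx≤y =
    let z , σz≡y = surjective y
        x≤z      = trans (le-preserved x z) (trans (cong (le X (σ x)) σz≡y) σx≤y)
    in trans (sym σz≡y) (cong σ (x-maximal z x≤z))

  IsMaximal-reflected : ∀ {x} → IsMaximal X (σ x) → IsMaximal X x
  IsMaximal-reflected {x} σx-maximal y x≤y =
    injective (σx-maximal (σ y) (trans (sym (le-preserved x y)) x≤y))

module _ {A C : FinPoset} (ι : Fin (size A) → Fin (size C))
         (ι-injective : ∀ {x y} → ι x ≡ ι y → x ≡ y)
         (ι-le : ∀ x y → le C (ι x) (ι y) ≡ le A x y) where

  restriction-isAutomorphism : ∀ {σ ρ} → σ ∘ ι ≗ ι ∘ ρ →
                               (∀ {z y} → σ z ≡ ι y → ∃[ x ] z ≡ ι x) →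
                               IsAutomorphism C σ → IsAutomorphism A ρ
  restriction-isAutomorphism {σ} {ρ} σι≗ιρ ι-closed σ-aut = record
    { le-preserved = λ x y → begin
        le A x y                   ≡⟨ ι-le x y ⟨
        le C (ι x) (ι y)           ≡⟨ le-preserved (ι x) (ι y) ⟩
        le C (σ (ι x)) (σ (ι y))   ≡⟨ cong₂ (le C) (σι≗ιρ x) (σι≗ιρ y) ⟩
        le C (ι (ρ x)) (ι (ρ y))   ≡⟨ ι-le (ρ x) (ρ y) ⟩
        le A (ρ x) (ρ y)           ∎
    ; injective    = λ {x} {y} ρx≡ρy →
        ι-injective (injective (trans (σι≗ιρ x) (trans (cong ι ρx≡ρy) (sym (σι≗ιρ y)))))
    ; surjective   = λ y →
        let z , σz≡ιy = surjective (ι y)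
            x , z≡ιx  = ι-closed σz≡ιy
        in x , ι-injective (trans (sym (σι≗ιρ x)) (trans (cong σ (sym z≡ιx)) σz≡ιy))
    }
    where
    open IsAutomorphism σ-aut
    open ≡-Reasoning

-- Antichains

punchOut-cong₂ : ∀ {n} {i i′ j j′ : Fin (suc n)} {i≢j : i ≢ j} {i′≢j′ : i′ ≢ j′} →
                 i ≡ i′ → j ≡ j′ → punchOut i≢j ≡ punchOut i′≢j′
punchOut-cong₂ {i = i} refl refl = punchOut-cong i refl

remove-cong : ∀ {m n} i (π π′ : Permutation (suc m) (suc n)) →
              π ≈ π′ → remove i π ≈ remove i π′
remove-cong i _ _ π≈π′ k = punchOut-cong₂ (π≈π′ i) (π≈π′ (punchIn i k))

insert-cong : ∀ {m n} i j (ρ ρ′ : Permutation m n) →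
              ρ ≈ ρ′ → insert i j ρ ≈ insert i j ρ′
insert-cong i j _ _ ρ≈ρ′ k with i ≟ᶠ k
... | yes _  = refl
... | no i≢k = cong (punchIn j) (ρ≈ρ′ (punchOut i≢k))

permutation-isAutomorphism : ∀ {k} (π : Permutation′ k) → IsAutomorphism (antichain k) (π ⟨$⟩ʳ_)
permutation-isAutomorphism π = record
  { le-preserved = λ x y → let πx≟πy = π ⟨$⟩ʳ x ≟ᶠ π ⟨$⟩ʳ y in
      trans (isYes≗does (x ≟ᶠ y))
        (trans (does-⇔ (mk⇔ (cong (π ⟨$⟩ʳ_)) π-injective) (x ≟ᶠ y) πx≟πy) (sym (isYes≗does πx≟πy)))
  ; injective    = π-injective
  ; surjective   = λ y → π ⟨$⟩ˡ y , inverseʳ π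
  }
  where
  π-injective : ∀ {x y} → π ⟨$⟩ʳ x ≡ π ⟨$⟩ʳ y → x ≡ y
  π-injective πx≡πy = trans (sym (inverseˡ π)) (trans (cong (π ⟨$⟩ˡ_) πx≡πy) (inverseˡ π))

Aut-antichain-suc↔ : ∀ k → Aut (antichain (suc k)) ↔ (Fin (suc k) × Aut (antichain k))
Aut-antichain-suc↔ k = mk↔ₛ′ split merge split∘merge merge∘split
  where
  open ≡-Reasoning
  perm : ∀ {n} → Aut (antichain n) → Permutation′ n
  perm a = toPermutation (⟦⟧-isAutomorphism a)
  fromPerm : ∀ {n} → Permutation′ n → Aut (antichain n)
  fromPerm π = toAut (permutation-isAutomorphism π)
  perm∘fromPerm : ∀ {n} (π : Permutation′ n) → perm (fromPerm π) ≈ π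
  perm∘fromPerm π = ⟦toAut⟧ (permutation-isAutomorphism π)

  split : Aut (antichain (suc k)) → Fin (suc k) × Aut (antichain k)
  split a = ⟦ a ⟧ zero , fromPerm (remove zero (perm a))
  merge : Fin (suc k) × Aut (antichain k) → Aut (antichain (suc k))
  merge (j , b) = fromPerm (insert zero j (perm b))

  split∘merge : ∀ jb → split (merge jb) ≡ jb
  split∘merge (j , b) = cong (j ,_) (Aut-ext λ x → begin
    perm (fromPerm (remove zero π′)) ⟨$⟩ʳ x ≡⟨ perm∘fromPerm (remove zero π′) x ⟩
    remove zero π′ ⟨$⟩ʳ x                   ≡⟨ remove-cong zero π′ π (perm∘fromPerm π) x ⟩
    remove zero π ⟨$⟩ʳ x                    ≡⟨ remove-insert zero j ρ x ⟩
    ρ ⟨$⟩ʳ x                                ∎)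
    where
    ρ : Permutation′ k
    ρ = perm b
    π π′ : Permutation′ (suc k)
    π = insert zero j ρ
    π′ = perm (fromPerm π)
  merge∘split : ∀ a → merge (split a) ≡ a
  merge∘split a = Aut-ext λ x → begin
    perm (fromPerm π′) ⟨$⟩ʳ x           ≡⟨ perm∘fromPerm π′ x ⟩
    π′ ⟨$⟩ʳ x                           ≡⟨ insert-cong zero (π ⟨$⟩ʳ zero) ρ π⁻ (perm∘fromPerm π⁻) x ⟩
    insert zero (π ⟨$⟩ʳ zero) π⁻ ⟨$⟩ʳ x ≡⟨ insert-remove zero π x ⟩
    π ⟨$⟩ʳ x                            ∎
    where
    π π′ : Permutation′ (suc k)
    π⁻ ρ : Permutation′ k
    π = perm a
    π⁻ = remove zero π
    ρ = perm (fromPerm π⁻)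
    π′ = insert zero (π ⟨$⟩ʳ zero) ρ

cardAut-antichain : ∀ k → cardAut (antichain k) ≡ k !
cardAut-antichain zero    = refl
cardAut-antichain (suc k) = begin
  cardAut (antichain (suc k))
    ≡⟨ cardAut-↔ (↔-trans (Aut-antichain-suc↔ k) (×-Fin↔ ↔-refl (Aut↔Fin-cardAut (antichain k)))) ⟩
  suc k * cardAut (antichain k) ≡⟨ cong (suc k *_) (cardAut-antichain k) ⟩
  suc k * k !                   ∎
  where open ≡-Reasoning

-- Ordinal sums

_⊕_ : ∀ {m n} → (Fin m → Fin m) → (Fin n → Fin n) → Fin (m + n) → Fin (m + n)
_⊕_ {m} {n} σ τ = join m n ∘ Sum.map σ τ ∘ splitAt m

⊕-id : ∀ m n → id {A = Fin m} ⊕ id {A = Fin n} ≗ id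
⊕-id m n i = trans (cong (join m n) (Sum.map-id (splitAt m i))) (join-splitAt m n i)

module _ {m n : ℕ} where

  ⊕-↑ˡ : ∀ (σ : Fin m → Fin m) (τ : Fin n → Fin n) a → (σ ⊕ τ) (a ↑ˡ n) ≡ σ a ↑ˡ n
  ⊕-↑ˡ σ τ a = cong (join m n ∘ Sum.map σ τ) (splitAt-↑ˡ m a n)

  ⊕-↑ʳ : ∀ (σ : Fin m → Fin m) (τ : Fin n → Fin n) b → (σ ⊕ τ) (m ↑ʳ b) ≡ m ↑ʳ τ b
  ⊕-↑ʳ σ τ b = cong (join m n ∘ Sum.map σ τ) (splitAt-↑ʳ m n b)

  ⊕-∘ : ∀ (σ σ′ : Fin m → Fin m) (τ τ′ : Fin n → Fin n) →
        (σ ⊕ τ) ∘ (σ′ ⊕ τ′) ≗ (σ ∘ σ′) ⊕ (τ ∘ τ′)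
  ⊕-∘ σ σ′ τ τ′ i =
    cong (join m n) (trans (cong (Sum.map σ τ) (splitAt-join m n (Sum.map σ′ τ′ (splitAt m i))))
                           (Sum.map-map {f = σ′} {g = τ′} {f′ = σ} {g′ = τ} (splitAt m i)))

  ⊕-cong : ∀ {σ σ′ : Fin m → Fin m} {τ τ′ : Fin n → Fin n} →
           σ ≗ σ′ → τ ≗ τ′ → σ ⊕ τ ≗ σ′ ⊕ τ′
  ⊕-cong σ≗σ′ τ≗τ′ i = cong (join m n) (Sum.map-cong σ≗σ′ τ≗τ′ (splitAt m i))

  ⊕-unique : ∀ {ς σ τ} → ς ∘ (_↑ˡ n) ≗ (_↑ˡ n) ∘ σ → ς ∘ (m ↑ʳ_) ≗ (m ↑ʳ_) ∘ τ →
             ς ≗ σ ⊕ τ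
  ⊕-unique {ς} {σ} {τ} onˡ onʳ i =
    trans (cong ς (sym (join-splitAt m n i))) (on-join (splitAt m i))
    where
    on-join : ∀ u → ς (join m n u) ≡ join m n (Sum.map σ τ u)
    on-join (inj₁ a) = onˡ a
    on-join (inj₂ b) = onʳ b

  module _ {σ σ′ : Fin m → Fin m} {τ τ′ : Fin n → Fin n} (eq : σ ⊕ τ ≗ σ′ ⊕ τ′) where

    ⊕-injectiveˡ : σ ≗ σ′
    ⊕-injectiveˡ a =
      ↑ˡ-injective n _ _ (trans (sym (⊕-↑ˡ σ τ a)) (trans (eq (a ↑ˡ n)) (⊕-↑ˡ σ′ τ′ a)))

    ⊕-injectiveʳ : τ ≗ τ′
    ⊕-injectiveʳ b =
      ↑ʳ-injective m _ _ (trans (sym (⊕-↑ʳ σ τ b)) (trans (eq (m ↑ʳ b)) (⊕-↑ʳ σ′ τ′ b)))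

  ↑ˡ≢↑ʳ : ∀ (a : Fin m) (b : Fin n) → a ↑ˡ n ≢ m ↑ʳ b
  ↑ˡ≢↑ʳ a b eq
    with () ← trans (sym (splitAt-↑ˡ m a n)) (trans (cong (splitAt m) eq) (splitAt-↑ʳ m n b))

  module _ (σ : Fin m → Fin m) (τ : Fin n → Fin n) where

    ⊕-preimage-↑ˡ : ∀ {i a} → (σ ⊕ τ) i ≡ a ↑ˡ n → ∃[ a′ ] i ≡ a′ ↑ˡ n
    ⊕-preimage-↑ˡ {i} {a} eq with splitAt m i in split≡
    ... | inj₁ a′ = a′ , sym (splitAt⁻¹-↑ˡ split≡)
    ... | inj₂ b  = contradiction (sym eq) (↑ˡ≢↑ʳ a (τ b))

    ⊕-preimage-↑ʳ : ∀ {i b} → (σ ⊕ τ) i ≡ m ↑ʳ b → ∃[ b′ ] i ≡ m ↑ʳ b′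
    ⊕-preimage-↑ʳ {i} {b} eq with splitAt m i in split≡
    ... | inj₂ b′ = b′ , sym (splitAt⁻¹-↑ʳ split≡)
    ... | inj₁ a  = contradiction eq (↑ˡ≢↑ʳ (σ a) b)

module _ (X Y : FinPoset) where
  private
    m = size X
    n = size Y

  le⊎ : Fin m ⊎ Fin n → Fin m ⊎ Fin n → Bool
  le⊎ (inj₁ a) (inj₁ a′) = le X a a′
  le⊎ (inj₂ b) (inj₂ b′) = le Y b b′
  le⊎ (inj₁ _) (inj₂ _)  = true
  le⊎ (inj₂ _) (inj₁ _)  = false

  le-⊛ : ∀ i j → le (X ⊛ Y) i j ≡ le⊎ (splitAt m i) (splitAt m j)
  le-⊛ i j with splitAt m i | splitAt m j
  ... | inj₁ _ | inj₁ _ = refl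
  ... | inj₂ _ | inj₂ _ = refl
  ... | inj₁ _ | inj₂ _ = refl
  ... | inj₂ _ | inj₁ _ = refl

  le-⊛-join : ∀ u v → le (X ⊛ Y) (join m n u) (join m n v) ≡ le⊎ u v
  le-⊛-join u v = trans (le-⊛ _ _) (cong₂ le⊎ (splitAt-join m n u) (splitAt-join m n v))

  ⊕-isAutomorphism : ∀ {σ τ} → IsAutomorphism X σ → IsAutomorphism Y τ →
                     IsAutomorphism (X ⊛ Y) (σ ⊕ τ)
  ⊕-isAutomorphism {σ} {τ} σ-aut τ-aut = record
    { le-preserved = λ i j → let u = splitAt m i; v = splitAt m j in begin
        le (X ⊛ Y) i j                      ≡⟨ le-⊛ i j ⟩
        le⊎ u v                             ≡⟨ le⊎-map u v ⟩
        le⊎ (Sum.map σ τ u) (Sum.map σ τ v) ≡⟨ le-⊛-join (Sum.map σ τ u) (Sum.map σ τ v) ⟨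
        le (X ⊛ Y) ((σ ⊕ τ) i) ((σ ⊕ τ) j)  ∎
    ; injective    = λ {i} {j} σ⊕τi≡σ⊕τj → begin
        i                         ≡⟨ ⊕-inverseˡ i ⟨
        (σ⁻¹ ⊕ τ⁻¹) ((σ ⊕ τ) i)   ≡⟨ cong (σ⁻¹ ⊕ τ⁻¹) σ⊕τi≡σ⊕τj ⟩
        (σ⁻¹ ⊕ τ⁻¹) ((σ ⊕ τ) j)   ≡⟨ ⊕-inverseˡ j ⟩
        j                         ∎
    ; surjective   = λ i → (σ⁻¹ ⊕ τ⁻¹) i , ⊕-inverseʳ i
    }
    where
    open ≡-Reasoning
    σ-perm : Permutation′ m
    σ-perm = toPermutation σ-aut
    τ-perm : Permutation′ n
    τ-perm = toPermutation τ-aut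
    σ⁻¹ : Fin m → Fin m
    σ⁻¹ = σ-perm ⟨$⟩ˡ_
    τ⁻¹ : Fin n → Fin n
    τ⁻¹ = τ-perm ⟨$⟩ˡ_
    ⊕-inverseˡ : (σ⁻¹ ⊕ τ⁻¹) ∘ (σ ⊕ τ) ≗ id
    ⊕-inverseˡ i = trans (⊕-∘ σ⁻¹ σ τ⁻¹ τ i)
      (trans (⊕-cong (λ _ → inverseˡ σ-perm) (λ _ → inverseˡ τ-perm) i) (⊕-id m n i))
    ⊕-inverseʳ : (σ ⊕ τ) ∘ (σ⁻¹ ⊕ τ⁻¹) ≗ id
    ⊕-inverseʳ i = trans (⊕-∘ σ σ⁻¹ τ τ⁻¹ i)
      (trans (⊕-cong (λ _ → inverseʳ σ-perm) (λ _ → inverseʳ τ-perm) i) (⊕-id m n i))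
    le⊎-map : ∀ u v → le⊎ u v ≡ le⊎ (Sum.map σ τ u) (Sum.map σ τ v)
    le⊎-map (inj₁ a) (inj₁ a′) = IsAutomorphism.le-preserved σ-aut a a′
    le⊎-map (inj₂ b) (inj₂ b′) = IsAutomorphism.le-preserved τ-aut b b′
    le⊎-map (inj₁ _) (inj₂ _)  = refl
    le⊎-map (inj₂ _) (inj₁ _)  = refl

  ⊕-isAutomorphism⁻ : ∀ {σ τ} → IsAutomorphism (X ⊛ Y) (σ ⊕ τ) →
                      IsAutomorphism X σ × IsAutomorphism Y τ
  ⊕-isAutomorphism⁻ {σ} {τ} σ⊕τ-aut =
      restriction-isAutomorphism (_↑ˡ n) (↑ˡ-injective n _ _)
        (λ a a′ → le-⊛-join (inj₁ a) (inj₁ a′)) (⊕-↑ˡ σ τ) (⊕-preimage-↑ˡ σ τ) σ⊕τ-aut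
    , restriction-isAutomorphism (m ↑ʳ_) (↑ʳ-injective m _ _)
        (λ b b′ → le-⊛-join (inj₂ b) (inj₂ b′)) (⊕-↑ʳ σ τ) (⊕-preimage-↑ʳ σ τ) σ⊕τ-aut

  Aut-⊛↔× : (∀ {ς} → IsAutomorphism (X ⊛ Y) ς → ∃₂ λ σ τ → ς ≗ σ ⊕ τ) →
            Aut (X ⊛ Y) ↔ (Aut X × Aut Y)
  Aut-⊛↔× decompose = mk↔ₛ′ restrict glue restrict∘glue glue∘restrict
    where
    left : Aut (X ⊛ Y) → Fin m → Fin m
    left c = proj₁ (decompose (⟦⟧-isAutomorphism c))
    right : Aut (X ⊛ Y) → Fin n → Fin n
    right c = proj₁ (proj₂ (decompose (⟦⟧-isAutomorphism c)))
    ⟦⟧≗⊕ : ∀ c → ⟦ c ⟧ ≗ left c ⊕ right c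
    ⟦⟧≗⊕ c = proj₂ (proj₂ (decompose (⟦⟧-isAutomorphism c)))
    parts-aut : ∀ c → IsAutomorphism X (left c) × IsAutomorphism Y (right c)
    parts-aut c = ⊕-isAutomorphism⁻ (IsAutomorphism-resp-≗ (⟦⟧≗⊕ c) (⟦⟧-isAutomorphism c))

    restrict : Aut (X ⊛ Y) → Aut X × Aut Y
    restrict c = toAut (proj₁ (parts-aut c)) , toAut (proj₂ (parts-aut c))
    glue : Aut X × Aut Y → Aut (X ⊛ Y)
    glue (a , b) = toAut (⊕-isAutomorphism (⟦⟧-isAutomorphism a) (⟦⟧-isAutomorphism b))
    ⟦glue⟧ : ∀ a b → ⟦ glue (a , b) ⟧ ≗ ⟦ a ⟧ ⊕ ⟦ b ⟧
    ⟦glue⟧ a b = ⟦toAut⟧ (⊕-isAutomorphism (⟦⟧-isAutomorphism a) (⟦⟧-isAutomorphism b))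

    restrict∘glue : ∀ ab → restrict (glue ab) ≡ ab
    restrict∘glue (a , b) = cong₂ _,_
      (Aut-ext λ x → trans (⟦toAut⟧ (proj₁ (parts-aut c)) x) (⊕-injectiveˡ parts≗ x))
      (Aut-ext λ y → trans (⟦toAut⟧ (proj₂ (parts-aut c)) y) (⊕-injectiveʳ parts≗ y))
      where
      c = glue (a , b)
      parts≗ : left c ⊕ right c ≗ ⟦ a ⟧ ⊕ ⟦ b ⟧
      parts≗ i = trans (sym (⟦⟧≗⊕ c i)) (⟦glue⟧ a b i)
    glue∘restrict : ∀ c → glue (restrict c) ≡ c
    glue∘restrict c = Aut-ext λ i → begin
      ⟦ glue (a , b) ⟧ i   ≡⟨ ⟦glue⟧ a b i ⟩
      (⟦ a ⟧ ⊕ ⟦ b ⟧) i    ≡⟨ ⊕-cong (⟦toAut⟧ (proj₁ (parts-aut c))) (⟦toAut⟧ (proj₂ (parts-aut c))) i ⟩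
      (left c ⊕ right c) i ≡⟨ ⟦⟧≗⊕ c i ⟨
      ⟦ c ⟧ i              ∎
      where
      open ≡-Reasoning
      a = proj₁ (restrict c)
      b = proj₂ (restrict c)

  cardAut-⊛ : (∀ {ς} → IsAutomorphism (X ⊛ Y) ς → ∃₂ λ σ τ → ς ≗ σ ⊕ τ) →
              cardAut (X ⊛ Y) ≡ cardAut X * cardAut Y
  cardAut-⊛ decompose = cardAut-↔
    (↔-trans (Aut-⊛↔× decompose) (×-Fin↔ (Aut↔Fin-cardAut X) (Aut↔Fin-cardAut Y)))

module _ (X : FinPoset) (k : ℕ) where
  private
    m = size X
    n = suc k
    Z = X ⊛ antichain n

  ↑ʳ-maximal : ∀ b → IsMaximal Z (m ↑ʳ b)
  ↑ʳ-maximal b i b≤i = sym (splitAt⁻¹-↑ʳ (le⊎-inj₂ (splitAt m i) (trans (sym le≡le⊎) b≤i)))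
    where
    le≡le⊎ : le Z (m ↑ʳ b) i ≡ le⊎ X (antichain n) (inj₂ b) (splitAt m i)
    le≡le⊎ = trans (le-⊛ X (antichain n) (m ↑ʳ b) i)
                   (cong (λ u → le⊎ X (antichain n) u (splitAt m i)) (splitAt-↑ʳ m n b))
    le⊎-inj₂ : ∀ u → le⊎ X (antichain n) (inj₂ b) u ≡ true → u ≡ inj₂ b
    le⊎-inj₂ (inj₂ b′) b≡b′ = cong inj₂ (sym (toWitness (from T-≡ b≡b′)))
    le⊎-inj₂ (inj₁ _)  ()

  ↑ˡ-not-maximal : ∀ a → ¬ IsMaximal Z (a ↑ˡ n)
  ↑ˡ-not-maximal a a-maximal =
    ↑ˡ≢↑ʳ a zero (sym (a-maximal (m ↑ʳ zero) (le-⊛-join X (antichain n) (inj₁ a) (inj₂ zero))))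

  ⊛-antichain-decompose : ∀ {ς} → IsAutomorphism Z ς → ∃₂ λ σ τ → ς ≗ σ ⊕ τ
  ⊛-antichain-decompose {ς} ς-aut =
    proj₁ ∘ image-↑ˡ , proj₁ ∘ image-↑ʳ ,
    ⊕-unique (proj₂ ∘ image-↑ˡ) (proj₂ ∘ image-↑ʳ)
    where
    image-↑ˡ : ∀ a → ∃[ a′ ] ς (a ↑ˡ n) ≡ a′ ↑ˡ n
    image-↑ˡ a with splitAt m (ς (a ↑ˡ n)) in split≡
    ... | inj₁ a′ = a′ , sym (splitAt⁻¹-↑ˡ split≡)
    ... | inj₂ b  = contradiction
      (IsMaximal-reflected ς-aut (subst (IsMaximal Z) (splitAt⁻¹-↑ʳ split≡) (↑ʳ-maximal b)))
      (↑ˡ-not-maximal a)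
    image-↑ʳ : ∀ b → ∃[ b′ ] ς (m ↑ʳ b) ≡ m ↑ʳ b′
    image-↑ʳ b with splitAt m (ς (m ↑ʳ b)) in split≡
    ... | inj₂ b′ = b′ , sym (splitAt⁻¹-↑ʳ split≡)
    ... | inj₁ a  = contradiction
      (subst (IsMaximal Z) (sym (splitAt⁻¹-↑ˡ split≡)) (IsMaximal-preserved ς-aut (↑ʳ-maximal b)))
      (↑ˡ-not-maximal a)

  cardAut-⊛-antichain : cardAut (X ⊛ antichain (suc k)) ≡ cardAut X * suc k !
  cardAut-⊛-antichain = trans (cardAut-⊛ X (antichain n) ⊛-antichain-decompose)
                              (cong (cardAut X *_) (cardAut-antichain n))

cardAut-Δ : ∀ m k i → cardAut (Δ m (suc k) i) ≡ m ! * (suc k !) ^ i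
cardAut-Δ m k zero    = trans (cardAut-antichain m) (sym (*-identityʳ (m !)))
cardAut-Δ m k (suc i) = begin
  cardAut (Δ m q i ⊛ antichain q) ≡⟨ cardAut-⊛-antichain (Δ m q i) k ⟩
  cardAut (Δ m q i) * q !         ≡⟨ cong (_* q !) (cardAut-Δ m k i) ⟩
  m ! * (q !) ^ i * q !           ≡⟨ *-assoc (m !) ((q !) ^ i) (q !) ⟩
  m ! * ((q !) ^ i * q !)         ≡⟨ cong (m ! *_) (*-comm ((q !) ^ i) (q !)) ⟩
  m ! * (q !) ^ suc i             ∎
  where
  open ≡-Reasoning
  q = suc k

-- Riordan matrices of constant series

IsConstant : PS → Set
IsConstant a = ∀ n → a (suc n) ≡ 0ℚ

sumTo-zero : ∀ n (f : ℕ → ℚ) → (∀ k → f k ≡ 0ℚ) → sumTo n f ≡ 0ℚ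
sumTo-zero zero    f f≡0 = f≡0 0
sumTo-zero (suc n) f f≡0 = cong₂ ℚ._+_ (sumTo-zero n f f≡0) (f≡0 (suc n))

·-isConstant : ∀ a b → IsConstant a → IsConstant b → IsConstant (a · b)
·-isConstant a b a-const b-const n = sumTo-zero (suc n) _ term
  where
  term : ∀ k → a k ℚ.* b (suc n ∸ k) ≡ 0ℚ
  term zero    = trans (cong (a 0 ℚ.*_) (b-const n)) (ℚ.*-zeroʳ (a 0))
  term (suc k) = trans (cong (ℚ._* b (n ∸ k)) (a-const k)) (ℚ.*-zeroˡ (b (n ∸ k)))

^ₚ-isConstant : ∀ a k → IsConstant a → IsConstant (a ^ₚ k)
^ₚ-isConstant a zero    a-const _ = refl
^ₚ-isConstant a (suc k) a-const   = ·-isConstant a (a ^ₚ k) a-const (^ₚ-isConstant a k a-const)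

-- invAux is private to Defs, so vanishes abstracts over the earlier coefficients b of 1/ω;
-- they only occur multiplied by ω (suc k) = 0.
invPS-isConstant : ∀ ω .{{_ : NonZero (ω 0)}} → IsConstant ω → IsConstant (invPS ω)
invPS-isConstant ω ω-const n = trans (if-cong (dec-false (suc n ≤? n) (n≮n n))) (vanishes _)
  where
  vanishes : ∀ (b : ℕ → ℚ) → ℚ.- (1/ ω 0) ℚ.* sumTo n (λ k → ω (suc k) ℚ.* b k) ≡ 0ℚ
  vanishes b = trans (cong (ℚ.- (1/ ω 0) ℚ.*_) (sumTo-zero n _ λ k →
                 trans (cong (ℚ._* b k) (ω-const k)) (ℚ.*-zeroˡ (b k))))
               (ℚ.*-zeroʳ (ℚ.- (1/ ω 0)))

xPow-diagonal : ∀ i (a : PS) → xPow i a i ≡ a 0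
xPow-diagonal i a = trans (if-cong (dec-true (i ≤? i) ≤-refl)) (cong a (n∸n≡0 i))

xPow-offDiagonal : ∀ a → IsConstant a → ∀ {i j} → i ≢ j → xPow j a i ≡ 0ℚ
xPow-offDiagonal a a-const {i} {j} i≢j with j ≤ᵇ i in j≤ᵇi | i ∸ j in i∸j
... | false | _     = refl
... | true  | zero  =
  contradiction (≤-antisym (m∸n≡0⇒m≤n i∸j) (≤ᵇ⇒≤ j i (from T-≡ j≤ᵇi))) i≢j
... | true  | suc k = a-const k

constantTerm-^ₚ : ∀ a k → (a ^ₚ k) 0 ≡ a 0 ^ℚ k
constantTerm-^ₚ a zero    = refl
constantTerm-^ₚ a (suc k) = cong (a 0 ℚ.*_) (constantTerm-^ₚ a k)

T-constant : ∀ α ω .{{_ : NonZero (ω 0)}} → IsConstant α → IsConstant ω →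
             ∀ i j → T α ω i j ≡ (if ⌊ i ℕ.≟ j ⌋ then α 0 ℚ.* (1/ ω 0) ^ℚ suc i else 0ℚ)
T-constant α ω α-const ω-const i j with i ℕ.≟ j
... | yes refl = trans (xPow-diagonal i (α · (invPS ω ^ₚ suc i)))
                       (cong (α 0 ℚ.*_) (constantTerm-^ₚ (invPS ω) (suc i)))
... | no i≢j   = xPow-offDiagonal (α · ω⁻ʲ⁻¹) (·-isConstant α ω⁻ʲ⁻¹ α-const ω⁻ʲ⁻¹-const) i≢j
  where
  ω⁻ʲ⁻¹ : PS
  ω⁻ʲ⁻¹ = invPS ω ^ₚ suc j
  ω⁻ʲ⁻¹-const : IsConstant ω⁻ʲ⁻¹
  ω⁻ʲ⁻¹-const = ^ₚ-isConstant (invPS ω) (suc j) (invPS-isConstant ω ω-const)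

-- Rational arithmetic

/-cong-cross : ∀ a b c d → a * suc d ≡ c * suc b → (+ a) / suc b ≡ (+ c) / suc d
/-cong-cross a b c d ad≡cb =
  ℚ.fromℚᵘ-cong {ℚᵘ.mkℚᵘ (+ a) b} {ℚᵘ.mkℚᵘ (+ c) d} (ℚᵘ.*≡* (begin
  + a ℤ.* + suc d ≡⟨ pos-* a (suc d) ⟨
  + (a * suc d)   ≡⟨ cong +_ ad≡cb ⟩
  + (c * suc b)   ≡⟨ pos-* c (suc b) ⟩
  + c ℤ.* + suc b ∎))
  where open ≡-Reasoning

/-*-/ : ∀ a b c d → ((+ a) / suc b) ℚ.* ((+ c) / suc d) ≡ (+ (a * c)) / (suc b * suc d)
/-*-/ a b c d = ℚ.toℚᵘ-injective (begin
  ℚ.toℚᵘ (x ℚ.* y)                ≈⟨ ℚ.toℚᵘ-homo-* x y ⟩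
  ℚ.toℚᵘ x ℚᵘ.* ℚ.toℚᵘ y          ≈⟨ ℚᵘ.*-cong (ℚ.toℚᵘ-fromℚᵘ x′) (ℚ.toℚᵘ-fromℚᵘ y′) ⟩
  x′ ℚᵘ.* y′                      ≡⟨ cong (λ n → ℚᵘ.mkℚᵘ n (ℕ.pred (suc b * suc d))) (pos-* a c) ⟨
  ℚᵘ.mkℚᵘ (+ (a * c)) (ℕ.pred (suc b * suc d))
                                  ≈⟨ ℚ.toℚᵘ-fromℚᵘ _ ⟨
  ℚ.toℚᵘ ((+ (a * c)) / (suc b * suc d)) ∎)
  where
  open ℚᵘ.≃-Reasoning
  x′ = ℚᵘ.mkℚᵘ (+ a) b
  y′ = ℚᵘ.mkℚᵘ (+ c) d
  x = ℚ.fromℚᵘ x′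
  y = ℚ.fromℚᵘ y′

fromℕ-* : ∀ a b → fromℕ (a * b) ≡ fromℕ a ℚ.* fromℕ b
fromℕ-* a b = sym (/-*-/ a 0 b 0)

fromℕ-^ : ∀ a k → fromℕ (a ^ k) ≡ fromℕ a ^ℚ k
fromℕ-^ a zero    = refl
fromℕ-^ a (suc k) = trans (fromℕ-* a (a ^ k)) (cong (fromℕ a ℚ.*_) (fromℕ-^ a k))

/-*-fromℕ : ∀ a b .{{_ : ℕ.NonZero b}} → ((+ a) / b) ℚ.* fromℕ b ≡ fromℕ a
/-*-fromℕ a (suc b) =
  trans (/-*-/ a b (suc b) 0) (/-cong-cross (a * suc b) (b * 1) a 0 (*-assoc a (suc b) 1))

1/-unique : ∀ p .{{_ : NonZero p}} {r} → p ℚ.* r ≡ 1ℚ → 1/ p ≡ r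
1/-unique p {r} pr≡1 = begin
  1/ p                 ≡⟨ ℚ.*-identityʳ (1/ p) ⟨
  1/ p ℚ.* 1ℚ          ≡⟨ cong (1/ p ℚ.*_) pr≡1 ⟨
  1/ p ℚ.* (p ℚ.* r)   ≡⟨ ℚ.*-assoc (1/ p) p r ⟨
  (1/ p ℚ.* p) ℚ.* r   ≡⟨ cong (ℚ._* r) (ℚ.*-inverseˡ p) ⟩
  1ℚ ℚ.* r             ≡⟨ ℚ.*-identityˡ r ⟩
  r                    ∎
  where open ≡-Reasoning

1/[1/n]≡n : ∀ n .{{_ : ℕ.NonZero n}} .{{_ : NonZero ((+ 1) / n)}} → 1/ ((+ 1) / n) ≡ fromℕ n
1/[1/n]≡n n = 1/-unique ((+ 1) / n) (/-*-fromℕ 1 n)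

cardAut-Δ≡riordan-diagonal : ∀ m k i → let q = suc k in
  fromℕ (cardAut (Δ m q i)) ≡ αₘ,q m q 0 ℚ.* ((1/ ωq q 0) {{ωq-nonZero q}}) ^ℚ suc i
cardAut-Δ≡riordan-diagonal m k i = begin
  fromℕ (cardAut (Δ m q i))          ≡⟨ cong fromℕ (cardAut-Δ m k i) ⟩
  fromℕ (m ! * (q !) ^ i)            ≡⟨ fromℕ-* (m !) ((q !) ^ i) ⟩
  fromℕ (m !) ℚ.* fromℕ ((q !) ^ i)  ≡⟨ cong₂ ℚ._*_ (sym (/-*-fromℕ (m !) (q !))) (fromℕ-^ (q !) i) ⟩
  (α₀ ℚ.* Q) ℚ.* Q ^ℚ i              ≡⟨ ℚ.*-assoc α₀ Q (Q ^ℚ i) ⟩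
  α₀ ℚ.* Q ^ℚ suc i                  ≡⟨ cong (λ x → α₀ ℚ.* x ^ℚ suc i) (1/[1/n]≡n (q !)) ⟨
  α₀ ℚ.* (1/ ωq q 0) ^ℚ suc i        ∎
  where
  open ≡-Reasoning
  q = suc k
  α₀ = αₘ,q m q 0
  Q = fromℕ (q !)
  instance
    _ = q !≢0
    _ = ωq-nonZero q

corollary5p21 : (∀ (m q : ℕ) → m > 0 → q > 0 →
                   ∀ (i j : ℕ) → C m q i j ≡ T (αₘ,q m q) (ωq q) {{ωq-nonZero q}} i j)
                × (∀ (i j : ℕ) → C 1 1 i j ≡ I i j)
corollary5p21 = riordan , identity
  where
  riordan : ∀ m q → m > 0 → q > 0 → ∀ i j → C m q i j ≡ T (αₘ,q m q) (ωq q) {{ωq-nonZero q}} i j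
  riordan m zero    _ ()
  riordan m (suc k) _ _ i j =
    trans (if-cong-then ⌊ i ℕ.≟ j ⌋ (cardAut-Δ≡riordan-diagonal m k i))
          (sym (T-constant (αₘ,q m (suc k)) (ωq (suc k)) {{ωq-nonZero (suc k)}}
                           (λ _ → refl) (λ _ → refl) i j))
  identity : ∀ i j → C 1 1 i j ≡ I i j
  identity i j =
    if-cong-then ⌊ i ℕ.≟ j ⌋ (cong fromℕ (trans (cardAut-Δ 1 0 i) (cong (1 *_) (^-zeroˡ i))))
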